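{- Let $\mathcal H$ be an hourglass graph on $n$ vertices. Then for every integer $k$ with $2\le k\le n$, the graph $\operatorname{FS}(\mathcal H,\mathcal B_{n-k}^{(k)})$ is connected.
   Context: An hourglass is a graph obtained from two vertex-disjoint cycles by identifying one vertex of the first cycle with one vertex of the second. The shared vertex is called the throat. For simple graphs $\mathcal G,\mathcal F$ on $n$ vertices, $\operatorname{FS}(\mathcal G,\mathcal F)$ has as vertices the bijections $\sigma:\mathtt V(\mathcal G)\to\mathtt V(\mathcal F)$. Two such bijections $\sigma,\sigma'$ are adjacent iff there is an edge $\{A,B\}$ of $\mathcal G$ such that $\{\sigma(A),\sigma(B)\}\in E(\mathcal F)$, $\sigma'(A)=\sigma(B)$, $\sigma'(B)=\sigma(A)$, and $\sigma'=\sigma$ elsewhere. For $1\le k\le n$, $\mathcal B_{n-k}^{(k)}$ is the graph on $n$ vertices with $k$ vertices adjacent to all other vertices and the remaining $n-k$ vertices pairwise non-adjacent. -}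

module Defs where

open import Data.Nat using (ℕ; zero; suc; _+_; _∸_; _≤_; _<_)
open import Data.Fin using (Fin; toℕ)
open import Data.Fin.Permutation using (Permutation′; _⟨$⟩ʳ_)
open import Data.Product using (Σ; _×_; _,_; ∃)
open import Data.Sum using (_⊎_)
open import Relation.Nullary using (¬_)
open import Relation.Binary.PropositionalEquality using (_≡_; _≢_)
open import Relation.Binary.Construct.Closure.ReflexiveTransitive using (Star)

record SimpleGraph (n : ℕ) : Set₁ where
  field
    Adj    : Fin n → Fin n → Set
    sym    : ∀ {u v} → Adj u v → Adj v u
    irrefl : ∀ {u} → ¬ Adj u u
open SimpleGraph public

-- Directed edges of the standard hourglass with cycle lengths p and q
-- (p , q ≥ 3) on vertex labels 0 .. p + q - 2 (as naturals):
-- throat 0; first cycle 0 - 1 - ... - (p-1) - 0;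
-- second cycle 0 - p - (p+1) - ... - (p+q-2) - 0.
data HGEdge (p q : ℕ) : ℕ → ℕ → Set where
  c1step  : ∀ a → suc a < p → HGEdge p q a (suc a)
  c1close : HGEdge p q (p ∸ 1) 0
  c2open  : HGEdge p q 0 p
  c2step  : ∀ a → p ≤ a → suc a < p + q ∸ 1 → HGEdge p q a (suc a)
  c2close : HGEdge p q (p + q ∸ 2) 0

HGAdj : ℕ → ℕ → ℕ → ℕ → Set
HGAdj p q a b = HGEdge p q a b ⊎ HGEdge p q b a

IsHourglass : {n : ℕ} → SimpleGraph n → Set
IsHourglass {n} H =
  Σ ℕ λ p → Σ ℕ λ q → 3 ≤ p × 3 ≤ q × n ≡ p + q ∸ 1 ×
  Σ (Permutation′ n) λ f →
    ∀ u v → (Adj H u v → HGAdj p q (toℕ (f ⟨$⟩ʳ u)) (toℕ (f ⟨$⟩ʳ v)))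
          × (HGAdj p q (toℕ (f ⟨$⟩ʳ u)) (toℕ (f ⟨$⟩ʳ v)) → Adj H u v)

BGraph : (n k : ℕ) → SimpleGraph n
BGraph n k = record
  { Adj    = λ u v → u ≢ v × (toℕ u < k ⊎ toℕ v < k)
  ; sym    = λ { (ne , Data.Sum.inj₁ x) → (λ e → ne (Relation.Binary.PropositionalEquality.sym e)) , Data.Sum.inj₂ x
               ; (ne , Data.Sum.inj₂ x) → (λ e → ne (Relation.Binary.PropositionalEquality.sym e)) , Data.Sum.inj₁ x }
  ; irrefl = λ { (ne , _) → ne Relation.Binary.PropositionalEquality.refl }
  }

FSAdj : {n : ℕ} → SimpleGraph n → SimpleGraph n →
        Permutation′ n → Permutation′ n → Set
FSAdj {n} G F σ σ' =
  Σ (Fin n) λ A → Σ (Fin n) λ B →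
    Adj G A B × Adj F (σ ⟨$⟩ʳ A) (σ ⟨$⟩ʳ B) ×
    σ' ⟨$⟩ʳ A ≡ σ ⟨$⟩ʳ B × σ' ⟨$⟩ʳ B ≡ σ ⟨$⟩ʳ A ×
    (∀ x → x ≢ A → x ≢ B → σ' ⟨$⟩ʳ x ≡ σ ⟨$⟩ʳ x)

-- FS(G , F) is connected: any two bijections are joined by a path
-- (bijections are identified when they agree pointwise).
FSConnected : {n : ℕ} → SimpleGraph n → SimpleGraph n → Set
FSConnected {n} G F =
  ∀ (σ τ : Permutation′ n) →
    Σ (Permutation′ n) λ ρ → Star (FSAdj G F) σ ρ × (∀ x → ρ ⟨$⟩ʳ x ≡ τ ⟨$⟩ʳ x)

-- Read FS(H, B) as a sliding puzzle on the hourglass whose tokens are the vertices of B; the tokens 0 and 1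
-- are adjacent to everything in B, so they act as two blanks that may trade places with any neighbouring
-- token. First the blanks are parked at the throat and at its neighbour 1. With the blanks parked, three
-- relays through the throat exchange the tokens on its two other neighbours P and p, and taking the throat's
-- blank once round a cycle rotates that cycle. Conjugating the exchange by these rotations realises every
-- transposition of the unparked positions, so any two parked configurations are joined by sorting.
module Submission where

open import Defs hiding (sym; irrefl)
open import Data.Nat using (ℕ; zero; suc; _+_; _∸_; _≤_; _<_; _⊓_; z≤n; s≤s; _<?_; _≤?_)
open import Data.Nat.Properties
open import Data.Fin using (Fin; toℕ; fromℕ<) renaming (zero to 0F; suc to sucF)
open import Data.Fin.Properties using (toℕ<n; toℕ-fromℕ<; toℕ-injective)
open import Data.Fin.Permutation using (Permutation′; permutation; _⟨$⟩ʳ_; _⟨$⟩ˡ_; _∘ₚ_; _≈_; inverseˡ; inverseʳ)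
open import Data.Product using (Σ; _×_; _,_; proj₁; proj₂)
open import Data.Sum using (_⊎_; inj₁; inj₂)
open import Function using (_∘_; id)
open import Function.Bundles using (Injection)
open import Function.Properties.Inverse using (↔⇒↣)
open import Relation.Binary.Definitions using (DecidableEquality; tri<; tri≈; tri>)
open import Relation.Nullary using (Dec; yes; no; contradiction)
open import Relation.Binary.PropositionalEquality
open import Relation.Binary.Construct.Closure.ReflexiveTransitive using (Star; ε; _◅_; _◅◅_; reverse)

module Transposition {a} {A : Set a} (_≟_ : DecidableEquality A) where

  swap : A → A → A → A
  swap x y z with z ≟ x
  ... | yes _ = y
  ... | no _ with z ≟ y
  ...   | yes _ = x
  ...   | no _ = z

  swap-left : ∀ x y → swap x y x ≡ y
  swap-left x y with x ≟ x
  ... | yes _ = refl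
  ... | no x≢x = contradiction refl x≢x

  swap-right : ∀ x y → swap x y y ≡ x
  swap-right x y with y ≟ x
  ... | yes y≡x = y≡x
  ... | no _ with y ≟ y
  ...   | yes _ = refl
  ...   | no y≢y = contradiction refl y≢y

  swap-other : ∀ x y {z} → z ≢ x → z ≢ y → swap x y z ≡ z
  swap-other x y {z} z≢x z≢y with z ≟ x
  ... | yes z≡x = contradiction z≡x z≢x
  ... | no _ with z ≟ y
  ...   | yes z≡y = contradiction z≡y z≢y
  ...   | no _ = refl

  swap-cases : ∀ x y z → z ≡ x ⊎ z ≡ y ⊎ (z ≢ x × z ≢ y)
  swap-cases x y z with z ≟ x | z ≟ y
  ... | yes z≡x | _ = inj₁ z≡x
  ... | no _ | yes z≡y = inj₂ (inj₁ z≡y)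
  ... | no z≢x | no z≢y = inj₂ (inj₂ (z≢x , z≢y))

  swap-comm : ∀ x y z → swap x y z ≡ swap y x z
  swap-comm x y z with swap-cases x y z
  ... | inj₁ refl = trans (swap-left z y) (sym (swap-right y z))
  ... | inj₂ (inj₁ refl) = trans (swap-right x z) (sym (swap-left z x))
  ... | inj₂ (inj₂ (z≢x , z≢y)) = trans (swap-other x y z≢x z≢y) (sym (swap-other y x z≢y z≢x))

  swap-involutive : ∀ x y z → swap x y (swap x y z) ≡ z
  swap-involutive x y z with swap-cases x y z
  ... | inj₁ refl = trans (cong (swap z y) (swap-left z y)) (swap-right z y)
  ... | inj₂ (inj₁ refl) = trans (cong (swap x z) (swap-right x z)) (swap-left x z)
  ... | inj₂ (inj₂ (z≢x , z≢y)) =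
    trans (cong (swap x y) (swap-other x y z≢x z≢y)) (swap-other x y z≢x z≢y)

  swap-self : ∀ x z → swap x x z ≡ z
  swap-self x z with swap-cases x x z
  ... | inj₁ refl = swap-left z z
  ... | inj₂ (inj₁ refl) = swap-left z z
  ... | inj₂ (inj₂ (z≢x , _)) = swap-other x x z≢x z≢x

  swap-injective : ∀ x y {z w} → swap x y z ≡ swap x y w → z ≡ w
  swap-injective x y {z} {w} eq =
    trans (sym (swap-involutive x y z)) (trans (cong (swap x y) eq) (swap-involutive x y w))

module _ {a b} {A : Set a} {B : Set b} (_≟ᴬ_ : DecidableEquality A) (_≟ᴮ_ : DecidableEquality B) where
  private
    module A = Transposition _≟ᴬ_
    module B = Transposition _≟ᴮ_

  swap-natural : (e : A → B) {x y z : A} → (e z ≡ e x → z ≡ x) → (e z ≡ e y → z ≡ y) →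
                 B.swap (e x) (e y) (e z) ≡ e (A.swap x y z)
  swap-natural e {x} {y} {z} inj-x inj-y with A.swap-cases x y z
  ... | inj₁ refl = trans (B.swap-left (e z) (e y)) (sym (cong e (A.swap-left z y)))
  ... | inj₂ (inj₁ refl) = trans (B.swap-right (e x) (e z)) (sym (cong e (A.swap-right x z)))
  ... | inj₂ (inj₂ (z≢x , z≢y)) =
    trans (B.swap-other (e x) (e y) (z≢x ∘ inj-x) (z≢y ∘ inj-y)) (sym (cong e (A.swap-other x y z≢x z≢y)))

module FinTransposition {n : ℕ} = Transposition (Data.Fin.Properties._≟_ {n})

transposition : ∀ {n} → Fin n → Fin n → Permutation′ n
transposition x y = permutation (swap x y) (swap x y) (swap-involutive x y) (swap-involutive x y)
  where open FinTransposition

open Transposition Data.Nat._≟_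

swap-conjugate : ∀ a b u v i → swap a b (swap u v (swap a b i)) ≡ swap (swap a b u) (swap a b v) i
swap-conjugate a b u v i = sym (begin
  swap (swap a b u) (swap a b v) i                    ≡⟨ cong (swap _ _) (sym (swap-involutive a b i)) ⟩
  swap (swap a b u) (swap a b v) (swap a b (swap a b i))
    ≡⟨ swap-natural Data.Nat._≟_ Data.Nat._≟_ (swap a b) {u} {v} {swap a b i}
                    (swap-injective a b) (swap-injective a b) ⟩
  swap a b (swap u v (swap a b i))                    ∎)
  where open ≡-Reasoning

swap-triangle : ∀ {a b c} → b ≢ a → b ≢ c → ∀ i → swap a b (swap c a (swap b c i)) ≡ swap a c i
swap-triangle {a} {b} {c} b≢a b≢c i = begin
  swap a b (swap c a (swap b c i))
    ≡⟨ cong (λ j → swap a b (swap c a (swap b c j))) (sym (swap-involutive c a i)) ⟩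
  swap a b (swap c a (swap b c (swap c a (swap c a i))))
    ≡⟨ cong (swap a b) (swap-conjugate c a b c (swap c a i)) ⟩
  swap a b (swap (swap c a b) (swap c a c) (swap c a i))
    ≡⟨ cong₂ (λ u v → swap a b (swap u v (swap c a i))) (swap-other c a b≢c b≢a) (swap-left c a) ⟩
  swap a b (swap b a (swap c a i))   ≡⟨ cong (swap a b) (swap-comm b a (swap c a i)) ⟩
  swap a b (swap a b (swap c a i))   ≡⟨ swap-involutive a b (swap c a i) ⟩
  swap c a i                         ≡⟨ swap-comm c a i ⟩
  swap a c i                         ∎
  where open ≡-Reasoning

≢0∧≢1⇒2≤ : ∀ {i} → i ≢ 0 → i ≢ 1 → 2 ≤ i
≢0∧≢1⇒2≤ {zero} i≢0 _ = contradiction refl i≢0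
≢0∧≢1⇒2≤ {suc zero} _ i≢1 = contradiction refl i≢1
≢0∧≢1⇒2≤ {suc (suc i)} _ _ = s≤s (s≤s z≤n)

swap-fixes-0-1 : ∀ {a b} → 2 ≤ a → 2 ≤ b → swap a b 0 ≡ 0 × swap a b 1 ≡ 1
swap-fixes-0-1 {a} {b} 2≤a 2≤b =
  swap-other a b (<⇒≢ (≤-trans (s≤s z≤n) 2≤a)) (<⇒≢ (≤-trans (s≤s z≤n) 2≤b)) ,
  swap-other a b (<⇒≢ 2≤a) (<⇒≢ 2≤b)

Bounded : ℕ → (ℕ → ℕ) → Set
Bounded t g = ∀ {i} → i ≤ t → g i ≤ t

∘-bounded : ∀ {t g h} → Bounded t g → Bounded t h → Bounded t (g ∘ h)
∘-bounded g-bounded h-bounded = g-bounded ∘ h-bounded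

swap-bounded : ∀ {t a b} → a ≤ t → b ≤ t → Bounded t (swap a b)
swap-bounded {a = a} {b} a≤t b≤t {i} i≤t with swap-cases a b i
... | inj₁ refl = subst (_≤ _) (sym (swap-left i b)) b≤t
... | inj₂ (inj₁ refl) = subst (_≤ _) (sym (swap-right a i)) a≤t
... | inj₂ (inj₂ (i≢a , i≢b)) = subst (_≤ _) (sym (swap-other a b i≢a i≢b)) i≤t

walk : ℕ → ℕ → ℕ → ℕ
walk s zero = id
walk s (suc d) = swap s (suc s) ∘ walk (suc s) d

walk-end : ∀ s d → walk s d (s + d) ≡ s
walk-end s zero = +-identityʳ s
walk-end s (suc d) = begin
  swap s (suc s) (walk (suc s) d (s + suc d)) ≡⟨ cong (swap s (suc s) ∘ walk (suc s) d) (+-suc s d) ⟩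
  swap s (suc s) (walk (suc s) d (suc s + d)) ≡⟨ cong (swap s (suc s)) (walk-end (suc s) d) ⟩
  swap s (suc s) (suc s)                      ≡⟨ swap-right s (suc s) ⟩
  s                                           ∎
  where open ≡-Reasoning

walk-below : ∀ {s i} d → i < s → walk s d i ≡ i
walk-below zero i<s = refl
walk-below {s} (suc d) i<s =
  trans (cong (swap s (suc s)) (walk-below d (m<n⇒m<1+n i<s)))
        (swap-other s (suc s) (<⇒≢ i<s) (<⇒≢ (m<n⇒m<1+n i<s)))

walk-above : ∀ {s i} d → s + d < i → walk s d i ≡ i
walk-above {s} zero s+0<i = refl
walk-above {s} {i} (suc d) s+d<i =
  trans (cong (swap s (suc s)) (walk-above d (subst (_< i) (+-suc s d) s+d<i)))
        (swap-other s (suc s) (>⇒≢ (≤-<-trans (m≤m+n s (suc d)) s+d<i))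
                              (>⇒≢ (≤-<-trans (s≤s (m≤m+n s d)) (subst (_< i) (+-suc s d) s+d<i))))

walk-inside : ∀ {s i} d → s ≤ i → i < s + d → walk s d i ≡ suc i
walk-inside {s} {i} zero s≤i i<s+0 = contradiction (subst (i <_) (+-identityʳ s) i<s+0) (≤⇒≯ s≤i)
walk-inside {s} {i} (suc d) s≤i i<s+d with m≤n⇒m<n∨m≡n s≤i
... | inj₂ refl = trans (cong (swap s (suc s)) (walk-below d (n<1+n s))) (swap-left s (suc s))
... | inj₁ s<i =
  trans (cong (swap s (suc s)) (walk-inside d s<i (subst (i <_) (+-suc s d) i<s+d)))
        (swap-other s (suc s) (>⇒≢ (m<n⇒m<1+n s<i)) (>⇒≢ (s≤s s<i)))

walk-injective : ∀ s d {i j} → walk s d i ≡ walk s d j → i ≡ j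
walk-injective s zero eq = eq
walk-injective s (suc d) eq = walk-injective (suc s) d (swap-injective s (suc s) eq)

swap-walk-swap≗walk : ∀ {s} d → 0 < s → swap 0 s ∘ walk s d ∘ swap (s + d) 0 ≗ walk s d
swap-walk-swap≗walk {s} d 0<s i with swap-cases (s + d) 0 i
... | inj₁ refl = begin
  swap 0 s (walk s d (swap (s + d) 0 (s + d))) ≡⟨ cong (swap 0 s ∘ walk s d) (swap-left (s + d) 0) ⟩
  swap 0 s (walk s d 0)                        ≡⟨ cong (swap 0 s) (walk-below d 0<s) ⟩
  swap 0 s 0                                   ≡⟨ swap-left 0 s ⟩
  s                                            ≡⟨ sym (walk-end s d) ⟩
  walk s d (s + d)                             ∎
  where open ≡-Reasoning
... | inj₂ (inj₁ refl) = begin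
  swap 0 s (walk s d (swap (s + d) 0 0)) ≡⟨ cong (swap 0 s ∘ walk s d) (swap-right (s + d) 0) ⟩
  swap 0 s (walk s d (s + d))            ≡⟨ cong (swap 0 s) (walk-end s d) ⟩
  swap 0 s s                             ≡⟨ swap-right 0 s ⟩
  0                                      ≡⟨ sym (walk-below d 0<s) ⟩
  walk s d 0                             ∎
  where open ≡-Reasoning
... | inj₂ (inj₂ (i≢s+d , i≢0)) =
  trans (cong (swap 0 s ∘ walk s d) (swap-other (s + d) 0 i≢s+d i≢0))
        (swap-other 0 s (λ eq → i≢0 (walk-injective s d (trans eq (sym (walk-below d 0<s)))))
                        (λ eq → i≢s+d (walk-injective s d (trans eq (sym (walk-end s d))))))

walk-then-swap-0 : ∀ s d → walk s d (swap (s + d) 0 0) ≡ s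
walk-then-swap-0 s d = trans (cong (walk s d) (swap-right (s + d) 0)) (walk-end s d)

walk-then-swap-below : ∀ {s i} d → 0 < i → i < s → walk s d (swap (s + d) 0 i) ≡ i
walk-then-swap-below {s} d 0<i i<s =
  trans (cong (walk s d) (swap-other (s + d) 0 (<⇒≢ (<-≤-trans i<s (m≤m+n s d))) (>⇒≢ 0<i))) (walk-below d i<s)

walk-bounded : ∀ {t} s d → s + d ≤ t → Bounded t (walk s d)
walk-bounded s zero s+0≤t i≤t = i≤t
walk-bounded {t} s (suc d) s+d≤t i≤t =
  swap-bounded (≤-trans (m≤m+n s (suc d)) s+d≤t) (≤-trans (s≤s (m≤m+n s d)) s+d+1≤t)
               (walk-bounded (suc s) d s+d+1≤t i≤t)
  where s+d+1≤t = subst (_≤ t) (+-suc s d) s+d≤t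

module Reachability {n : ℕ} (G F : SimpleGraph n) where

  infix 4 _~_
  record _~_ (σ τ : Permutation′ n) : Set where
    constructor joinedVia
    field
      endpoint  : Permutation′ n
      path      : Star (FSAdj G F) σ endpoint
      endpoint≈ : endpoint ≈ τ

  FSAdj-respˡ : ∀ {σ σ′ τ} → σ ≈ σ′ → FSAdj G F σ τ → FSAdj G F σ′ τ
  FSAdj-respˡ σ≈σ′ (A , B , adjG , adjF , τA , τB , τ-rest) =
    A , B , adjG , subst₂ (Adj F) (σ≈σ′ A) (σ≈σ′ B) adjF ,
    trans τA (σ≈σ′ B) , trans τB (σ≈σ′ A) , λ x x≢A x≢B → trans (τ-rest x x≢A x≢B) (σ≈σ′ x)

  FSAdj-sym : ∀ {σ τ} → FSAdj G F σ τ → FSAdj G F τ σ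
  FSAdj-sym (A , B , adjG , adjF , τA , τB , τ-rest) =
    A , B , adjG , subst₂ (Adj F) (sym τA) (sym τB) (SimpleGraph.sym F adjF) ,
    sym τB , sym τA , λ x x≢A x≢B → sym (τ-rest x x≢A x≢B)

  ≈⇒~ : ∀ {σ τ} → σ ≈ τ → σ ~ τ
  ≈⇒~ {σ} σ≈τ = joinedVia σ ε σ≈τ

  ~-refl : ∀ {σ} → σ ~ σ
  ~-refl = ≈⇒~ λ _ → refl

  ~-respˡ-≈ : ∀ {σ σ′ τ} → σ ≈ σ′ → σ ~ τ → σ′ ~ τ
  ~-respˡ-≈ σ≈σ′ (joinedVia ρ ε ρ≈τ) = ≈⇒~ λ x → trans (sym (σ≈σ′ x)) (ρ≈τ x)
  ~-respˡ-≈ {σ} {σ′} σ≈σ′ (joinedVia ρ (_◅_ {j = υ} adj path) ρ≈τ) =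
    joinedVia ρ (FSAdj-respˡ {σ} {σ′} {υ} σ≈σ′ adj ◅ path) ρ≈τ

  ~-trans : ∀ {σ τ υ} → σ ~ τ → τ ~ υ → σ ~ υ
  ~-trans (joinedVia ρ path ρ≈τ) τ~υ with ~-respˡ-≈ (λ x → sym (ρ≈τ x)) τ~υ
  ... | joinedVia ρ′ path′ ρ′≈υ = joinedVia ρ′ (path ◅◅ path′) ρ′≈υ

  ~-sym : ∀ {σ τ} → σ ~ τ → τ ~ σ
  ~-sym {σ} (joinedVia ρ path ρ≈τ) = ~-respˡ-≈ ρ≈τ (joinedVia σ (reverse (λ {u} {v} → FSAdj-sym {u} {v}) path) λ _ → refl)

  FSConnected-from-~ : (∀ σ τ → σ ~ τ) → FSConnected G F
  FSConnected-from-~ connected σ τ = endpoint , path , endpoint≈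
    where open _~_ (connected σ τ)

  ~-swap : ∀ {σ A B} → Adj G A B → Adj F (σ ⟨$⟩ʳ A) (σ ⟨$⟩ʳ B) → σ ~ transposition A B ∘ₚ σ
  ~-swap {σ} {A} {B} adjG adjF = joinedVia (transposition A B ∘ₚ σ) (move ◅ ε) λ _ → refl
    where
    open FinTransposition using () renaming (swap-left to swapᶠ-left; swap-right to swapᶠ-right; swap-other to swapᶠ-other)
    move : FSAdj G F σ (transposition A B ∘ₚ σ)
    move = A , B , adjG , adjF , cong (σ ⟨$⟩ʳ_) (swapᶠ-left A B) , cong (σ ⟨$⟩ʳ_) (swapᶠ-right A B) ,
           λ x x≢A x≢B → cong (σ ⟨$⟩ʳ_) (swapᶠ-other A B x≢A x≢B)

module HourglassPuzzle (P′ Q′ k : ℕ) (2≤k : 2 ≤ k)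
  (H : SimpleGraph (suc (suc (P′ + suc (suc (suc Q′))))))
  (f : Permutation′ (suc (suc (P′ + suc (suc (suc Q′))))))
  (edge⇒adj : ∀ u v → HGAdj (suc (suc (suc P′))) (suc (suc (suc Q′))) (toℕ (f ⟨$⟩ʳ u)) (toℕ (f ⟨$⟩ʳ v)) →
              Adj H u v)
  where

  -- The cycles have lengths p and Q: P = p - 1 closes the first cycle, p opens the second, m closes it.
  P p Q m : ℕ
  P = suc (suc P′)
  p = suc P
  Q = suc (suc (suc Q′))
  m = suc (P′ + Q)

  Perm : Set
  Perm = Permutation′ (suc m)

  open Reachability H (BGraph (suc m) k) public

  Edge : ℕ → ℕ → Set
  Edge = HGAdj p Q

  p<m : p < m
  p<m = s≤s (subst (_≤ P′ + Q) (+-comm P′ 3) (+-monoʳ-≤ P′ (s≤s (s≤s (s≤s z≤n)))))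

  p+[1+Q′]≡m : p + suc Q′ ≡ m
  p+[1+Q′]≡m = cong suc (sym (trans (+-suc P′ (suc (suc Q′))) (cong suc (+-suc P′ (suc Q′)))))

  p≤m : p ≤ m
  p≤m = <⇒≤ p<m

  P≤m : P ≤ m
  P≤m = ≤-trans (n≤1+n P) p≤m

  2≤P : 2 ≤ P
  2≤P = s≤s (s≤s z≤n)

  2≤p : 2 ≤ p
  2≤p = s≤s (s≤s z≤n)

  edge-bounded : ∀ {a b} → Edge a b → a ≤ m × b ≤ m
  edge-bounded (inj₁ e) = directed e
    where
    directed : ∀ {a b} → HGEdge p Q a b → a ≤ m × b ≤ m
    directed (c1step a a+1<p) = ≤-trans (n≤1+n a) a+1≤m , a+1≤m
      where a+1≤m = ≤-trans (≤-pred a+1<p) P≤m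
    directed c1close = P≤m , z≤n
    directed c2open = z≤n , <⇒≤ p<m
    directed (c2step a _ a+1<m+1) = ≤-trans (n≤1+n a) (≤-pred a+1<m+1) , ≤-pred a+1<m+1
    directed c2close = ≤-refl , z≤n
  edge-bounded (inj₂ e) = Data.Product.swap (edge-bounded (inj₁ e))

  -- Positions are the labels of the standard hourglass; labels beyond m are clamped to m.
  vertexAt : ℕ → Fin (suc m)
  vertexAt i = f ⟨$⟩ˡ fromℕ< (s≤s (m⊓n≤n i m))

  label : Fin (suc m) → ℕ
  label x = toℕ (f ⟨$⟩ʳ x)

  label≤m : ∀ x → label x ≤ m
  label≤m x = ≤-pred (toℕ<n (f ⟨$⟩ʳ x))

  label-vertexAt : ∀ {i} → i ≤ m → label (vertexAt i) ≡ i
  label-vertexAt {i} i≤m = begin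
    toℕ (f ⟨$⟩ʳ (f ⟨$⟩ˡ fromℕ< _)) ≡⟨ cong toℕ (inverseʳ f) ⟩
    toℕ (fromℕ< (s≤s (m⊓n≤n i m)))  ≡⟨ toℕ-fromℕ< (s≤s (m⊓n≤n i m)) ⟩
    i ⊓ m                            ≡⟨ m≤n⇒m⊓n≡m i≤m ⟩
    i                                ∎
    where open ≡-Reasoning

  vertexAt-label : ∀ x → vertexAt (label x) ≡ x
  vertexAt-label x = trans (cong (f ⟨$⟩ˡ_) (toℕ-injective (trans (toℕ-fromℕ< _) (m≤n⇒m⊓n≡m (label≤m x)))))
                           (inverseˡ f)

  vertexAt-injective : ∀ {i j} → i ≤ m → j ≤ m → vertexAt i ≡ vertexAt j → i ≡ j
  vertexAt-injective i≤m j≤m eq = trans (sym (label-vertexAt i≤m)) (trans (cong label eq) (label-vertexAt j≤m))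

  tokenAt : Perm → ℕ → Fin (suc m)
  tokenAt σ i = σ ⟨$⟩ʳ vertexAt i

  tokenAt-injective : ∀ σ {i j} → i ≤ m → j ≤ m → tokenAt σ i ≡ tokenAt σ j → i ≡ j
  tokenAt-injective σ i≤m j≤m eq = vertexAt-injective i≤m j≤m (Injection.injective (↔⇒↣ σ) eq)

  swapAt : ℕ → ℕ → Perm → Perm
  swapAt a b σ = transposition (vertexAt a) (vertexAt b) ∘ₚ σ

  record Rearranged (σ : Perm) (g : ℕ → ℕ) (τ : Perm) : Set where
    constructor rearrangement
    field
      moved : ∀ i → i ≤ m → tokenAt τ i ≡ tokenAt σ (g i)
  open Rearranged public

  rearranged⇒≈ : ∀ {ρ g σ τ} → Rearranged ρ g σ → Rearranged ρ g τ → σ ≈ τ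
  rearranged⇒≈ {σ = σ} {τ} σ-layout τ-layout x =
    subst (λ y → σ ⟨$⟩ʳ y ≡ τ ⟨$⟩ʳ y) (vertexAt-label x)
          (trans (moved σ-layout (label x) (label≤m x)) (sym (moved τ-layout (label x) (label≤m x))))

  rearranged-∘ : ∀ {σ τ υ g h} → Bounded m h → Rearranged σ g τ → Rearranged τ h υ → Rearranged σ (g ∘ h) υ
  rearranged-∘ h-bounded τ-layout υ-layout =
    rearrangement λ i i≤m → trans (moved υ-layout i i≤m) (moved τ-layout _ (h-bounded i≤m))

  swapAt-rearranged : ∀ {a b} σ → a ≤ m → b ≤ m → Rearranged σ (swap a b) (swapAt a b σ)
  swapAt-rearranged σ a≤m b≤m = rearrangement λ i i≤m →
    cong (σ ⟨$⟩ʳ_) (swap-natural Data.Nat._≟_ Data.Fin.Properties._≟_ vertexAt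
                      (vertexAt-injective i≤m a≤m) (vertexAt-injective i≤m b≤m))

  infix 4 _⇝_
  record _⇝_ (σ : Perm) (g : ℕ → ℕ) : Set where
    constructor _via_
    field
      {target} : Perm
      reach    : σ ~ target
      layout   : Rearranged σ g target

  ⇝-id : ∀ {σ} → σ ⇝ id
  ⇝-id = ~-refl via rearrangement λ _ _ → refl

  ⇝-resp : ∀ {σ g h} → g ≗ h → σ ⇝ g → σ ⇝ h
  ⇝-resp {σ} g≗h (reach via layout) =
    reach via rearrangement λ i i≤m → trans (moved layout i i≤m) (cong (tokenAt σ) (g≗h i))

  ⇝-∘ : ∀ {σ g h} → Bounded m h → σ ⇝ g → (∀ {τ} → Rearranged σ g τ → τ ⇝ h) → σ ⇝ g ∘ h
  ⇝-∘ h-bounded (reach via layout) continue with continue layout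
  ... | reach′ via layout′ = ~-trans reach reach′ via rearranged-∘ h-bounded layout layout′

  ⇝⇒~ : ∀ {σ g τ} → σ ⇝ g → Rearranged σ g τ → σ ~ τ
  ⇝⇒~ (reach via layout) τ-layout = ~-trans reach (≈⇒~ (rearranged⇒≈ layout τ-layout))

  ⇝-cancelʳ : ∀ {σ τ g h} → Bounded m g → Rearranged σ h τ → τ ⇝ g → σ ⇝ h ∘ g → σ ⇝ h
  ⇝-cancelʳ g-bounded τ-layout (reach via layout) σ⇝h∘g =
    ~-trans (⇝⇒~ σ⇝h∘g (rearranged-∘ g-bounded τ-layout layout)) (~-sym reach) via τ-layout

  -- Since 2 ≤ k, the tokens 0 and 1 are adjacent to every vertex of B: they are the blanks of a sliding puzzle.
  Blank : Fin (suc m) → Set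
  Blank t = toℕ t < 2

  blank-moved : ∀ {σ g τ i j} → Rearranged σ g τ → i ≤ m → g i ≡ j → Blank (tokenAt σ j) → Blank (tokenAt τ i)
  blank-moved {σ} layout i≤m gi≡j = subst Blank (sym (trans (moved layout _ i≤m) (cong (tokenAt σ) gi≡j)))

  ⇝-swap : ∀ {σ a b} → Edge a b → Blank (tokenAt σ a) ⊎ Blank (tokenAt σ b) → σ ⇝ swap a b
  ⇝-swap {σ} {a} {b} edge blank = ~-swap adjH adjB via swapAt-rearranged σ a≤m b≤m
    where
    a≤m = proj₁ (edge-bounded edge)
    b≤m = proj₂ (edge-bounded edge)
    adjH : Adj H (vertexAt a) (vertexAt b)
    adjH = edge⇒adj _ _ (subst₂ Edge (sym (label-vertexAt a≤m)) (sym (label-vertexAt b≤m)) edge)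
    adjB : Adj (BGraph (suc m) k) (tokenAt σ a) (tokenAt σ b)
    adjB = (λ eq → SimpleGraph.irrefl H (subst (Adj H (vertexAt a)) (sym (Injection.injective (↔⇒↣ σ) eq)) adjH)) ,
           Data.Sum.map (λ t<2 → ≤-trans t<2 2≤k) (λ t<2 → ≤-trans t<2 2≤k) blank

  ⇝-walk : ∀ {σ} s d → s + d ≤ m → (∀ i → s ≤ i → i < s + d → Edge i (suc i)) → Blank (tokenAt σ s) →
           σ ⇝ walk s d
  ⇝-walk s zero _ _ _ = ⇝-id
  ⇝-walk s (suc d) s+d≤m edges blank =
    ⇝-∘ (walk-bounded (suc s) d s+d≤m′) (⇝-swap (edges s ≤-refl (subst (s <_) (sym (+-suc s d)) (s≤s (m≤m+n s d)))) (inj₁ blank)) λ layout →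
      ⇝-walk (suc s) d s+d≤m′ (λ i s<i i<s+d → edges i (<⇒≤ s<i) (subst (i <_) (sym (+-suc s d)) i<s+d))
             (blank-moved layout (≤-trans (s≤s (m≤m+n s d)) s+d≤m′) (swap-right s (suc s)) blank)
    where s+d≤m′ = subst (_≤ m) (+-suc s d) s+d≤m

  -- Taking the throat's blank once round the cycle shifts it exactly as a walk from s would.
  ⇝-rotate : ∀ {σ} s d → 0 < s → Edge 0 s → (∀ i → s ≤ i → i < s + d → Edge i (suc i)) → Edge (s + d) 0 →
             Blank (tokenAt σ 0) → σ ⇝ walk s d
  ⇝-rotate s d 0<s edge-in edges edge-out blank =
    ⇝-resp (swap-walk-swap≗walk d 0<s)
      (⇝-∘ (∘-bounded (walk-bounded s d end≤m) (swap-bounded end≤m z≤n)) (⇝-swap edge-in (inj₁ blank)) λ layout →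
        ⇝-∘ (swap-bounded end≤m z≤n) (⇝-walk s d end≤m edges (blank-at-s layout)) λ layout′ →
          ⇝-swap edge-out (inj₁ (blank-moved layout′ end≤m (walk-end s d) (blank-at-s layout))))
    where
    end≤m = proj₁ (edge-bounded edge-out)
    blank-at-s : ∀ {τ} → Rearranged _ (swap 0 s) τ → Blank (tokenAt τ s)
    blank-at-s layout = blank-moved layout (proj₂ (edge-bounded edge-in)) (swap-right 0 s) blank

  ⇝-swap-via-throat : ∀ {σ x y} → Edge 0 x → Edge 0 y → y ≢ 0 → y ≢ x →
                 Blank (tokenAt σ 0) → Blank (tokenAt σ y) → σ ⇝ swap x y
  ⇝-swap-via-throat {σ} {x} {y} edge-x edge-y y≢0 y≢x blank-0 blank-y =
    ⇝-resp conjugate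
      (⇝-∘ (∘-bounded (swap-bounded z≤n y≤m) (swap-bounded z≤n x≤m)) (⇝-swap edge-x (inj₁ blank-0)) λ layout →
        ⇝-∘ (swap-bounded z≤n x≤m) (⇝-swap edge-y (inj₂ (blank-at-y layout))) λ layout′ →
          ⇝-swap edge-x (inj₁ (blank-moved layout′ z≤n (swap-left 0 y) (blank-at-y layout))))
    where
    x≤m = proj₂ (edge-bounded edge-x)
    y≤m = proj₂ (edge-bounded edge-y)
    blank-at-y : ∀ {τ} → Rearranged σ (swap 0 x) τ → Blank (tokenAt τ y)
    blank-at-y layout = blank-moved layout y≤m (swap-other 0 x y≢0 y≢x) blank-y
    conjugate : swap 0 x ∘ swap 0 y ∘ swap 0 x ≗ swap x y
    conjugate i = trans (swap-conjugate 0 x 0 y i) (cong₂ (λ u v → swap u v i) (swap-left 0 x) (swap-other 0 x y≢0 y≢x))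

  record Blanks (σ : Perm) : Set where
    constructor blanksAt
    field
      at-0 : tokenAt σ 0 ≡ 0F
      at-1 : tokenAt σ 1 ≡ sucF 0F

  blank₀ : ∀ {σ} → Blanks σ → Blank (tokenAt σ 0)
  blank₀ (blanksAt at-0 _) = subst Blank (sym at-0) (s≤s z≤n)

  blank₁ : ∀ {σ} → Blanks σ → Blank (tokenAt σ 1)
  blank₁ (blanksAt _ at-1) = subst Blank (sym at-1) (s≤s (s≤s z≤n))

  blanks-rearranged : ∀ {σ g τ} → g 0 ≡ 0 → g 1 ≡ 1 → Rearranged σ g τ → Blanks σ → Blanks τ
  blanks-rearranged {σ} g0≡0 g1≡1 layout (blanksAt at-0 at-1) = blanksAt
    (trans (moved layout 0 z≤n) (trans (cong (tokenAt σ) g0≡0) at-0))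
    (trans (moved layout 1 (s≤s z≤n)) (trans (cong (tokenAt σ) g1≡1) at-1))

  Realisable : (ℕ → ℕ) → Set
  Realisable g = ∀ σ → Blanks σ → σ ⇝ g

  record Mover (g : ℕ → ℕ) : Set where
    field
      injective  : ∀ {i j} → g i ≡ g j → i ≡ j
      bounded    : Bounded m g
      fixes-0    : g 0 ≡ 0
      fixes-1    : g 1 ≡ 1
      realisable : Realisable g

  swap-mover : ∀ {a b} → 2 ≤ a → 2 ≤ b → a ≤ m → b ≤ m → Realisable (swap a b) → Mover (swap a b)
  swap-mover {a} {b} 2≤a 2≤b a≤m b≤m realisable = record
    { injective  = swap-injective a b
    ; bounded    = swap-bounded a≤m b≤m
    ; fixes-0    = proj₁ (swap-fixes-0-1 2≤a 2≤b)
    ; fixes-1    = proj₂ (swap-fixes-0-1 2≤a 2≤b)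
    ; realisable = realisable
    }

  realisable-conjugate : ∀ {g a b a′ b′} → Mover g → 2 ≤ a → 2 ≤ b → a ≤ m → b ≤ m →
                         g a ≡ a′ → g b ≡ b′ → Realisable (swap a b) → Realisable (swap a′ b′)
  realisable-conjugate {g} {a} {b} mover 2≤a 2≤b a≤m b≤m refl refl swap-ab σ blanks =
    ⇝-cancelʳ bounded (swapAt-rearranged σ (bounded a≤m) (bounded b≤m))
      (realisable _ (blanks-rearranged (proj₁ fixes) (proj₂ fixes) (swapAt-rearranged σ (bounded a≤m) (bounded b≤m)) blanks))
      (⇝-resp natural (⇝-∘ (swap-bounded a≤m b≤m) (realisable σ blanks) λ layout →
        swap-ab _ (blanks-rearranged fixes-0 fixes-1 layout blanks)))
    where
    open Mover mover
    moved-≥2 : ∀ {i} → 2 ≤ i → 2 ≤ g i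
    moved-≥2 2≤i = ≢0∧≢1⇒2≤ (λ gi≡0 → >⇒≢ (≤-trans (s≤s z≤n) 2≤i) (injective (trans gi≡0 (sym fixes-0))))
                             (λ gi≡1 → >⇒≢ 2≤i (injective (trans gi≡1 (sym fixes-1))))
    fixes = swap-fixes-0-1 (moved-≥2 2≤a) (moved-≥2 2≤b)
    natural : g ∘ swap a b ≗ swap (g a) (g b) ∘ g
    natural i = sym (swap-natural Data.Nat._≟_ Data.Nat._≟_ g injective injective)

  edge-0-1 : Edge 0 1
  edge-0-1 = inj₁ (c1step 0 (s≤s (s≤s z≤n)))

  edge-0-P : Edge 0 P
  edge-0-P = inj₂ c1close

  edge-0-p : Edge 0 p
  edge-0-p = inj₁ c2open

  edge-P-0 : Edge P 0
  edge-P-0 = inj₁ c1close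

  edge-m-0 : Edge m 0
  edge-m-0 = inj₁ c2close

  cycle₁-edge : ∀ i → i < P → Edge i (suc i)
  cycle₁-edge i i<P = inj₁ (c1step i (s≤s i<P))

  cycle₂-edge : ∀ i → p ≤ i → i < m → Edge i (suc i)
  cycle₂-edge i p≤i i<m = inj₁ (c2step i p≤i (s≤s i<m))

  -- Rotating the first cycle carries blank 1 round to P; a throat swap of 1 and P brings it back.
  rotate₁ : ℕ → ℕ
  rotate₁ = walk 1 (suc P′) ∘ swap 1 P

  rotate₁-mover : Mover rotate₁
  rotate₁-mover = record
    { injective  = swap-injective 1 P ∘ walk-injective 1 (suc P′)
    ; bounded    = ∘-bounded (walk-bounded 1 (suc P′) P≤m) (swap-bounded (s≤s z≤n) P≤m)
    ; fixes-0    = trans (cong (walk 1 (suc P′)) (swap-other 1 P (λ ()) (λ ()))) (walk-below (suc P′) (s≤s z≤n))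
    ; fixes-1    = trans (cong (walk 1 (suc P′)) (swap-left 1 P)) (walk-end 1 (suc P′))
    ; realisable = λ σ blanks →
        ⇝-∘ (swap-bounded (s≤s z≤n) P≤m)
            (⇝-rotate 1 (suc P′) (s≤s z≤n) edge-0-1 (λ i _ → cycle₁-edge i) edge-P-0 (blank₀ blanks)) λ layout →
          ⇝-swap-via-throat edge-0-1 edge-0-P (λ ()) (λ ())
            (blank-moved layout z≤n (walk-below (suc P′) (s≤s z≤n)) (blank₀ blanks))
            (blank-moved layout P≤m (walk-end 1 (suc P′)) (blank₁ blanks))
    }

  rotate₁-P : rotate₁ P ≡ 2
  rotate₁-P = trans (cong (walk 1 (suc P′)) (swap-right 1 P)) (walk-inside (suc P′) ≤-refl (s≤s (s≤s z≤n)))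

  rotate₁-inside : ∀ {i} → 2 ≤ i → i < P → rotate₁ i ≡ suc i
  rotate₁-inside 2≤i i<P = trans (cong (walk 1 (suc P′)) (swap-other 1 P (>⇒≢ 2≤i) (<⇒≢ i<P)))
                                 (walk-inside (suc P′) (≤-trans (s≤s z≤n) 2≤i) i<P)

  rotate₁-p : rotate₁ p ≡ p
  rotate₁-p = trans (cong (walk 1 (suc P′)) (swap-other 1 P (λ ()) 1+n≢n)) (walk-above (suc P′) ≤-refl)

  rotate₂ : ℕ → ℕ
  rotate₂ = walk p (suc Q′)

  rotate₂-mover : Mover rotate₂
  rotate₂-mover = record
    { injective  = walk-injective p (suc Q′)
    ; bounded    = walk-bounded p (suc Q′) (≤-reflexive p+[1+Q′]≡m)
    ; fixes-0    = walk-below (suc Q′) (s≤s z≤n)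
    ; fixes-1    = walk-below (suc Q′) (s≤s (s≤s z≤n))
    ; realisable = λ σ blanks →
        ⇝-rotate p (suc Q′) (s≤s z≤n) edge-0-p
          (λ i p≤i i<end → cycle₂-edge i p≤i (subst (i <_) p+[1+Q′]≡m i<end))
          (subst (λ end → Edge end 0) (sym p+[1+Q′]≡m) edge-m-0) (blank₀ blanks)
    }

  rotate₂-P : rotate₂ P ≡ P
  rotate₂-P = walk-below (suc Q′) (n<1+n P)

  rotate₂-inside : ∀ {i} → p ≤ i → i < m → rotate₂ i ≡ suc i
  rotate₂-inside {i} p≤i i<m = walk-inside (suc Q′) p≤i (subst (i <_) (sym p+[1+Q′]≡m) i<m)

  -- The token at P waits at 1 while the token at p moves to P, and then moves on to p.
  realisable-P-p : Realisable (swap P p)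
  realisable-P-p σ blanks =
    ⇝-resp (swap-triangle (λ ()) (λ ()))
      (⇝-∘ (∘-bounded (swap-bounded p≤m P≤m) (swap-bounded (s≤s z≤n) p≤m))
           (⇝-swap-via-throat edge-0-P edge-0-1 (λ ()) (λ ()) (blank₀ blanks) (blank₁ blanks)) λ layout →
        ⇝-∘ (swap-bounded (s≤s z≤n) p≤m)
            (⇝-swap-via-throat edge-0-p edge-0-P (λ ()) (<⇒≢ (n<1+n P)) (blank₀′ layout) (blank₁′ layout)) λ layout′ →
          ⇝-swap-via-throat edge-0-1 edge-0-p (λ ()) (λ ())
            (blank-moved layout′ z≤n (swap-other p P {0} (λ ()) (λ ())) (blank₀′ layout))
            (blank-moved layout′ p≤m (swap-left p P) (blank₁′ layout)))
    where
    blank₀′ : ∀ {τ} → Rearranged σ (swap P 1) τ → Blank (tokenAt τ 0)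
    blank₀′ layout = blank-moved layout z≤n (swap-other P 1 {0} (λ ()) (λ ())) (blank₀ blanks)
    blank₁′ : ∀ {τ} → Rearranged σ (swap P 1) τ → Blank (tokenAt τ P)
    blank₁′ layout = blank-moved layout P≤m (swap-left P 1) (blank₁ blanks)

  realisable-comm : ∀ {a b} → Realisable (swap a b) → Realisable (swap b a)
  realisable-comm {a} {b} realisable σ blanks = ⇝-resp (swap-comm a b) (realisable σ blanks)

  realisable-self : ∀ a → Realisable (swap a a)
  realisable-self a σ _ = ⇝-resp (sym ∘ swap-self a) ⇝-id

  realisable-cycle₁-p : ∀ {i} → 2 ≤ i → i ≤ P → Realisable (swap i p)
  realisable-cycle₁-p {suc j} 2≤i i≤P with m≤n⇒m<n∨m≡n 2≤i
  ... | inj₂ refl = realisable-conjugate rotate₁-mover 2≤P 2≤p P≤m p≤m rotate₁-P rotate₁-p realisable-P-p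
  ... | inj₁ 2<i =
    realisable-conjugate rotate₁-mover 2≤j 2≤p (≤-trans (n≤1+n j) (≤-trans i≤P P≤m)) p≤m
      (rotate₁-inside 2≤j i≤P) rotate₁-p (realisable-cycle₁-p 2≤j (≤-trans (n≤1+n j) i≤P))
    where 2≤j = ≤-pred 2<i

  realisable-P-cycle₂ : ∀ {i} → p ≤ i → i ≤ m → Realisable (swap P i)
  realisable-P-cycle₂ {suc j} p≤i i≤m with m≤n⇒m<n∨m≡n p≤i
  ... | inj₂ refl = realisable-P-p
  ... | inj₁ p<i =
    realisable-conjugate rotate₂-mover 2≤P (≤-trans 2≤p p≤j) P≤m (≤-trans (n≤1+n j) i≤m)
      rotate₂-P (rotate₂-inside p≤j i≤m) (realisable-P-cycle₂ p≤j (≤-trans (n≤1+n j) i≤m))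
    where p≤j = ≤-pred p<i

  realisable-with-p : ∀ {i} → 2 ≤ i → i ≤ m → Realisable (swap i p)
  realisable-with-p {i} 2≤i i≤m with <-cmp i p
  ... | tri< i<p _ _ = realisable-cycle₁-p 2≤i (≤-pred i<p)
  ... | tri≈ _ refl _ = realisable-self p
  ... | tri> _ _ p<i = realisable-comm
    (realisable-conjugate (swap-mover 2≤P 2≤p P≤m p≤m realisable-P-p) 2≤P 2≤i P≤m i≤m
      (swap-left P p) (swap-other P p (>⇒≢ (<-trans (n<1+n P) p<i)) (>⇒≢ p<i)) (realisable-P-cycle₂ (<⇒≤ p<i) i≤m))

  realisable-swap : ∀ {a b} → 2 ≤ a → 2 ≤ b → a ≤ m → b ≤ m → Realisable (swap a b)
  realisable-swap {a} {b} 2≤a 2≤b a≤m b≤m with swap-cases b p a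
  ... | inj₁ refl = realisable-self a
  ... | inj₂ (inj₁ refl) = realisable-comm (realisable-with-p 2≤b b≤m)
  ... | inj₂ (inj₂ (a≢b , a≢p)) =
    realisable-conjugate (swap-mover 2≤b 2≤p b≤m p≤m (realisable-with-p 2≤b b≤m))
      2≤a 2≤p a≤m p≤m (swap-other b p a≢b a≢p) (swap-right b p) (realisable-with-p 2≤a a≤m)

  locate : Perm → Fin (suc m) → ℕ
  locate σ t = label (σ ⟨$⟩ˡ t)

  tokenAt-locate : ∀ σ t → tokenAt σ (locate σ t) ≡ t
  tokenAt-locate σ t = trans (cong (σ ⟨$⟩ʳ_) (vertexAt-label _)) (inverseʳ σ)

  AgreeFrom : ℕ → Perm → Perm → Set
  AgreeFrom j σ τ = ∀ i → j ≤ i → i ≤ m → tokenAt σ i ≡ tokenAt τ i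

  agreeFrom-extend : ∀ {j σ τ} → tokenAt σ j ≡ tokenAt τ j → AgreeFrom (suc j) σ τ → AgreeFrom j σ τ
  agreeFrom-extend at-j rest i j≤i i≤m with m≤n⇒m<n∨m≡n j≤i
  ... | inj₁ j<i = rest i j<i i≤m
  ... | inj₂ refl = at-j

  blanks-agree : ∀ {σ τ j} → Blanks σ → Blanks τ → j < 2 → tokenAt σ j ≡ tokenAt τ j
  blanks-agree (blanksAt σ₀ _) (blanksAt τ₀ _) (s≤s z≤n) = trans σ₀ (sym τ₀)
  blanks-agree (blanksAt _ σ₁) (blanksAt _ τ₁) (s≤s (s≤s z≤n)) = trans σ₁ (sym τ₁)

  place-token : ∀ {j σ τ} → 2 ≤ j → j ≤ m → Blanks σ → Blanks τ → AgreeFrom (suc j) σ τ →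
                Σ Perm λ σ′ → σ ~ σ′ × Blanks σ′ × AgreeFrom j σ′ τ
  place-token {j} {σ} {τ} 2≤j j≤m σ-blanks τ-blanks agree =
    swapAt a j σ , ⇝⇒~ (realisable-swap 2≤a 2≤j a≤m j≤m σ σ-blanks) layout ,
    blanks-rearranged (proj₁ fixes) (proj₂ fixes) layout σ-blanks , agreeFrom-extend {j} {swapAt a j σ} {τ} at-j rest
    where
    a = locate σ (tokenAt τ j)
    a≤m = label≤m _
    at-a : tokenAt σ a ≡ tokenAt τ j
    at-a = tokenAt-locate σ _
    j≡a : tokenAt σ a ≡ tokenAt τ a → j ≡ a
    j≡a agree-a = tokenAt-injective τ j≤m a≤m (trans (sym at-a) agree-a)
    2≤a : 2 ≤ a
    2≤a = ≮⇒≥ λ a<2 → <⇒≱ (subst (_< 2) (sym (j≡a (blanks-agree σ-blanks τ-blanks a<2))) a<2) 2≤j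
    a≤j : a ≤ j
    a≤j = ≮⇒≥ λ j<a → <-irrefl (j≡a (agree a j<a a≤m)) j<a
    fixes = swap-fixes-0-1 2≤a 2≤j
    layout = swapAt-rearranged σ a≤m j≤m
    at-j : tokenAt (swapAt a j σ) j ≡ tokenAt τ j
    at-j = trans (moved layout j j≤m) (trans (cong (tokenAt σ) (swap-right a j)) at-a)
    rest : AgreeFrom (suc j) (swapAt a j σ) τ
    rest i j<i i≤m = trans (moved layout i i≤m)
      (trans (cong (tokenAt σ) (swap-other a j (>⇒≢ (≤-<-trans a≤j j<i)) (>⇒≢ j<i))) (agree i j<i i≤m))

  ~-from-agreement : ∀ j {σ τ} → j ≤ suc m → Blanks σ → Blanks τ → AgreeFrom j σ τ → σ ~ τ
  ~-from-agreement zero {σ} {τ} _ _ _ agree =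
    ≈⇒~ (rearranged⇒≈ {τ} {id} {σ} {τ} (rearrangement λ i i≤m → agree i z≤n i≤m) (rearrangement λ _ _ → refl))
  ~-from-agreement (suc j) {σ} {τ} j<m+1 σ-blanks τ-blanks agree = extend (j <? 2)
    where
    j≤m+1 = ≤-trans (n≤1+n j) j<m+1
    after-placing : (Σ Perm λ σ′ → σ ~ σ′ × Blanks σ′ × AgreeFrom j σ′ τ) → σ ~ τ
    after-placing (σ′ , σ~σ′ , σ′-blanks , agree′) =
      ~-trans σ~σ′ (~-from-agreement j j≤m+1 σ′-blanks τ-blanks agree′)
    extend : Dec (j < 2) → σ ~ τ
    extend (yes j<2) = ~-from-agreement j j≤m+1 σ-blanks τ-blanks
                         (agreeFrom-extend {j} {σ} {τ} (blanks-agree σ-blanks τ-blanks j<2) agree)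
    extend (no j≮2) = after-placing (place-token (≮⇒≥ j≮2) (≤-pred j<m+1) σ-blanks τ-blanks agree)

  ThroatReached : Perm → ℕ → Set
  ThroatReached σ j = Σ Perm λ τ → σ ~ τ × tokenAt τ 0 ≡ tokenAt σ j × (j ≢ 1 → tokenAt τ 1 ≡ tokenAt σ 1)

  walk-to-throat : ∀ {σ} s d → 0 < s → (∀ i → s ≤ i → i < s + d → Edge i (suc i)) → Edge (s + d) 0 →
                   Blank (tokenAt σ s) → ThroatReached σ s
  walk-to-throat {σ} s d 0<s edges edge-out blank = arrive journey
    where
    end≤m = proj₁ (edge-bounded edge-out)
    journey : σ ⇝ walk s d ∘ swap (s + d) 0
    journey = ⇝-∘ (swap-bounded end≤m z≤n) (⇝-walk s d end≤m edges blank) λ layout →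
                ⇝-swap edge-out (inj₁ (blank-moved layout end≤m (walk-end s d) blank))
    arrive : σ ⇝ walk s d ∘ swap (s + d) 0 → ThroatReached σ s
    arrive (reach via layout) =
      _ , reach , trans (moved layout 0 z≤n) (cong (tokenAt σ) (walk-then-swap-0 s d)) ,
      λ s≢1 → trans (moved layout 1 (s≤s z≤n))
                    (cong (tokenAt σ) (walk-then-swap-below d (s≤s z≤n) (≤∧≢⇒< 0<s (s≢1 ∘ sym))))

  move-to-throat : ∀ {σ j} → j ≤ m → Blank (tokenAt σ j) → ThroatReached σ j
  move-to-throat {σ} {zero} _ _ = σ , ~-refl , refl , λ _ → refl
  move-to-throat {σ} {suc j} j+1≤m blank with suc j ≤? P
  ... | yes j+1≤P = walk-to-throat (suc j) (P ∸ suc j) (s≤s z≤n)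
                      (λ i _ i<end → cycle₁-edge i (subst (i <_) end≡P i<end))
                      (subst (λ end → Edge end 0) (sym end≡P) edge-P-0) blank
    where end≡P = m+[n∸m]≡n j+1≤P
  ... | no j+1≰P = walk-to-throat (suc j) (m ∸ suc j) (s≤s z≤n)
                     (λ i j<i i<end → cycle₂-edge i (≤-trans (≰⇒> j+1≰P) j<i) (subst (i <_) end≡m i<end))
                     (subst (λ end → Edge end 0) (sym end≡m) edge-m-0) blank
    where end≡m = m+[n∸m]≡n j+1≤m

  Normalised : Perm → Set
  Normalised σ = Σ Perm λ τ → σ ~ τ × Blanks τ

  blank-located : ∀ σ {t} → Blank t → Blank (tokenAt σ (locate σ t))
  blank-located σ {t} = subst Blank (sym (tokenAt-locate σ t))

  park-token-1 : ∀ σ → Σ Perm λ τ → σ ~ τ × tokenAt τ 1 ≡ sucF 0F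
  park-token-1 σ with move-to-throat (label≤m _) (blank-located σ {sucF 0F} (s≤s (s≤s z≤n)))
  ... | τ , σ~τ , τ-at-0 , _ =
    target , ~-trans σ~τ reach ,
    trans (moved layout 1 (s≤s z≤n)) (trans (cong (tokenAt τ) (swap-right 0 1)) τ-at-0′)
    where
    τ-at-0′ = trans τ-at-0 (tokenAt-locate σ _)
    open _⇝_ (⇝-swap {τ} edge-0-1 (inj₁ (subst Blank (sym τ-at-0′) (s≤s (s≤s z≤n)))))

  normalise : ∀ σ → Normalised σ
  normalise σ with park-token-1 σ
  ... | τ , σ~τ , τ-at-1 with move-to-throat (label≤m _) (blank-located τ {0F} (s≤s z≤n))
  ...   | υ , τ~υ , υ-at-0 , keeps-1 =
    υ , ~-trans σ~τ τ~υ , blanksAt (trans υ-at-0 (tokenAt-locate τ 0F)) (trans (keeps-1 located≢1) τ-at-1)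
    where
    located≢1 : locate τ 0F ≢ 1
    located≢1 eq = contradiction (trans (sym (tokenAt-locate τ 0F)) (trans (cong (tokenAt τ) eq) τ-at-1)) λ ()

  connected : ∀ σ τ → σ ~ τ
  connected σ τ = join (normalise σ) (normalise τ)
    where
    join : Normalised σ → Normalised τ → σ ~ τ
    join (σ′ , σ~σ′ , σ′-blanks) (τ′ , τ~τ′ , τ′-blanks) =
      ~-trans σ~σ′ (~-trans (~-from-agreement (suc m) ≤-refl σ′-blanks τ′-blanks vacuous) (~-sym τ~τ′))
      where
      vacuous : AgreeFrom (suc m) σ′ τ′
      vacuous i m<i i≤m = contradiction i≤m (<⇒≱ m<i)

mainTheorem5 : (n : ℕ) (H : SimpleGraph n) → IsHourglass H →
    (k : ℕ) → 2 ≤ k → k ≤ n → FSConnected H (BGraph n k)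
mainTheorem5 _ H (_ , _ , s≤s (s≤s (s≤s {n = P′} _)) , s≤s (s≤s (s≤s {n = Q′} _)) , refl , f , iso) k 2≤k _ =
  Reachability.FSConnected-from-~ H (BGraph _ k) (HourglassPuzzle.connected P′ Q′ k 2≤k H f (λ u v → proj₂ (iso u v)))
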